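{- For every $n\ge1$, the triples $(\mathsf{omi},\mathsf{rpop},\mathsf{top})$ and $(\mathsf{omi},\mathsf{top},\mathsf{rpop})$ have the same distribution over $\mathfrak{DT}_n$; that is, for all $a,b,c$, $|\{T\in\mathfrak{DT}_n:(\mathsf{omi},\mathsf{rpop},\mathsf{top})(T)=(a,b,c)\}|=|\{T\in\mathfrak{DT}_n:(\mathsf{omi},\mathsf{top},\mathsf{rpop})(T)=(a,b,c)\}|$. In particular, the pair $(\mathsf{rpop},\mathsf{top})$ is symmetric over $\mathfrak{DT}_n$.
   Context: A di-sk tree is a rooted binary tree (each node has at most one left child and at most one right child) whose nodes are labeled $\oplus$ or $\ominus$, such that no node has the same label as its right child. $\mathfrak{DT}_n$ is the set of di-sk trees with $n-1$ nodes. $\mathsf{omi}(T)$ is the number of $\ominus$-nodes of $T$. For a traversal order, the number of initial $\oplus$-nodes is the number of nodes visited before the first $\ominus$-node (or the total number of nodes if there is none). $\mathsf{top}(T)$ is this number for the preorder traversal (root, then left subtree, then right subtree, recursively); equivalently the number of consecutive $\oplus$-nodes at the top of the leftmost path starting from the root. $\mathsf{rpop}(T)$ is this number for the right postorder traversal (right subtree, then left subtree, then root, recursively). -}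

module Defs where

open import Data.Nat using (ℕ; zero; suc; _+_; _≡ᵇ_; _∸_)
open import Data.Bool using (Bool; true; false; _∧_; not; T?)
open import Data.List using (List; []; _∷_; _++_; concatMap; filter; length; map; upTo)
open import Data.Product using (_×_; _,_)
open import Relation.Binary.PropositionalEquality using (_≡_)

data Label : Set where
  ⊕ ⊖ : Label

-- Rooted binary trees with labeled nodes; each node has an optional left
-- and optional right child (leaf = empty subtree).
data Tree : Set where
  leaf : Tree
  node : Label → Tree → Tree → Tree

size : Tree → ℕ
size leaf = 0
size (node _ l r) = suc (size l + size r)

sameLabel : Label → Label → Bool
sameLabel ⊕ ⊕ = true
sameLabel ⊖ ⊖ = true
sameLabel _ _ = false

isDiSk : Tree → Bool
isDiSk leaf = true
isDiSk (node x l leaf) = isDiSk l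
isDiSk (node x l r@(node y _ _)) = not (sameLabel x y) ∧ isDiSk l ∧ isDiSk r

-- All labeled binary trees of height ≤ d (height of leaf = 0), each exactly once.
labels : List Label
labels = ⊕ ∷ ⊖ ∷ []

treesHeight≤ : ℕ → List Tree
treesHeight≤ zero = leaf ∷ []
treesHeight≤ (suc d) =
  leaf ∷ concatMap (λ x → concatMap (λ l → map (λ r → node x l r) ts) ts) labels
  where
  ts = treesHeight≤ d

-- 𝔇𝔗 n : the di-sk trees with n - 1 nodes (for n ≥ 1), listed once each.
-- A tree with m nodes has height ≤ m, so treesHeight≤ m contains all of them.
DT : ℕ → List Tree
DT n = filter (λ T → T? ((size T ≡ᵇ m) ∧ isDiSk T)) (treesHeight≤ m)
  where m = n ∸ 1

omi : Tree → ℕ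
omi leaf = 0
omi (node ⊕ l r) = omi l + omi r
omi (node ⊖ l r) = suc (omi l + omi r)

preorder : Tree → List Label
preorder leaf = []
preorder (node x l r) = x ∷ preorder l ++ preorder r

rpostorder : Tree → List Label
rpostorder leaf = []
rpostorder (node x l r) = rpostorder r ++ rpostorder l ++ x ∷ []

initialPlus : List Label → ℕ
initialPlus [] = 0
initialPlus (⊕ ∷ xs) = suc (initialPlus xs)
initialPlus (⊖ ∷ xs) = 0

top : Tree → ℕ
top T = initialPlus (preorder T)

rpop : Tree → ℕ
rpop T = initialPlus (rpostorder T)

count3 : (Tree → ℕ) → (Tree → ℕ) → (Tree → ℕ) → List Tree → ℕ → ℕ → ℕ → ℕ
count3 f g h Ts a b c =
  length (filter (λ T → T? ((f T ≡ᵇ a) ∧ (g T ≡ᵇ b) ∧ (h T ≡ᵇ c))) Ts)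

-- There is an involution revTree on binary trees that reverses the preorder word: revTree of
-- a tree with root x, left subtree l and right subtree r is obtained by grafting revTree l and
-- a single node x below the last preorder node of revTree r.  Since the right postorder word
-- of any tree is the reverse of its preorder word, revTree exchanges top and rpop, and it
-- keeps omi and the size.  The last preorder node of revTree r carries the root label of r,
-- so the di-sk condition at x is preserved and revTree permutes DT n.
module Submission where

open import Defs
open import Data.Bool using (Bool; true; false; _∧_; T; T?)
open import Data.Bool.Properties using (T-∧)
open import Data.Empty using (⊥)
open import Data.List
  using (List; []; _∷_; _++_; _∷ʳ_; [_]; map; filter; length; reverse; concatMap; cartesianProductWith)
open import Data.List.Properties
  using (++-assoc; ++-identityʳ; unfold-reverse; reverse-++; reverse-involutive; length-++; filter-++; filter-≐; ∷ʳ-injectiveʳ)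
open import Data.List.Membership.Propositional using (_∈_)
open import Data.List.Membership.Propositional.Properties
  using (∈-++⁺ˡ; ∈-++⁺ʳ; ∈-map⁻; ∈-map⁺; ∈-filter⁻; ∈-filter⁺; ∈-cartesianProductWith⁺; ∈-cartesianProductWith⁻)
open import Data.List.Membership.Propositional.Properties.WithK using (unique∧set⇒bag)
open import Data.List.Relation.Binary.BagAndSetEquality using (∼bag⇒↭)
open import Data.List.Relation.Binary.Permutation.Propositional using (_↭_)
open import Data.List.Relation.Binary.Permutation.Propositional.Properties using (↭-length; filter-↭; ↭-reverse)
open import Data.List.Relation.Unary.All using ([]) renaming (tabulate to All-tabulate)
open import Data.List.Relation.Unary.All.Properties using () renaming (++⁺ to All-++⁺)
open import Data.List.Relation.Unary.Any using (here; there)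
open import Data.List.Relation.Unary.Unique.Propositional using (Unique)
open import Data.List.Relation.Unary.Unique.Propositional.Properties using (map⁺; ++⁺; filter⁺; cartesianProductWith⁺)
open import Data.List.Relation.Unary.AllPairs using ([]; _∷_)
open import Data.Nat using (ℕ; zero; suc; _+_; _≤_; _≥_; _∸_; _≡ᵇ_; s≤s)
open import Data.Nat.Properties using (m+n≤o⇒m≤o; m+n≤o⇒n≤o; ≤-reflexive; ≡ᵇ⇒≡; ≡⇒≡ᵇ)
open import Data.Product using (_×_; _,_; proj₁; proj₂; ∃; ∃₂)
open import Data.Unit using (⊤; tt)
open import Function using (_∘_; mk⇔; Equivalence)
open import Relation.Binary.PropositionalEquality
  using (_≡_; _≢_; refl; sym; trans; cong; cong₂; subst; ≢-sym; module ≡-Reasoning)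
open import Relation.Unary using (Pred; Decidable; _≐_)
open import Relation.Nullary using (¬_; yes; no; does)

⟦_⟧ : Label → Tree
⟦ x ⟧ = node x leaf leaf

IsNode : Tree → Set
IsNode leaf = ⊥
IsNode (node _ _ _) = ⊤

-- Gives the last node of s in preorder, which is childless, the children A and B (junk on leaf).
graft : Tree → Tree → Tree → Tree
graft leaf A B = leaf
graft (node y l (node z p q)) A B = node y l (graft (node z p q) A B)
graft (node y (node z p q) leaf) A B = node y (graft (node z p q) A B) leaf
graft (node y leaf leaf) A B = node y A B

join : Tree → Tree → Tree → Tree
join leaf leaf w = w
join leaf (node y p q) w = graft (node y p q) w leaf
join (node y p q) v w = graft (node y p q) v w

revTree : Tree → Tree
revTree leaf = leaf
revTree (node x l r) = join (revTree r) (revTree l) ⟦ x ⟧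

graft-isNode : ∀ s A B → IsNode s → IsNode (graft s A B)
graft-isNode (node y l (node z p q)) A B _ = tt
graft-isNode (node y (node z p q) leaf) A B _ = tt
graft-isNode (node y leaf leaf) A B _ = tt

join-isNode : ∀ u v w → IsNode w → IsNode (join u v w)
join-isNode leaf leaf w w≠leaf = w≠leaf
join-isNode leaf (node y p q) w _ = graft-isNode (node y p q) w leaf tt
join-isNode (node y p q) v w _ = graft-isNode (node y p q) v w tt

revTree-isNode : ∀ t → IsNode t → IsNode (revTree t)
revTree-isNode (node x l r) _ = join-isNode (revTree r) (revTree l) ⟦ x ⟧ tt

join-node : ∀ u v w → IsNode u → join u v w ≡ graft u v w
join-node (node y p q) v w _ = refl

join-leaf : ∀ v w → IsNode v → join leaf v w ≡ graft v w leaf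
join-leaf (node y p q) w _ = refl

graft-right : ∀ y l t A B → IsNode t → graft (node y l t) A B ≡ node y l (graft t A B)
graft-right y l (node z p q) A B _ = refl

graft-left : ∀ y t A B → IsNode t → graft (node y t leaf) A B ≡ node y (graft t A B) leaf
graft-left y (node z p q) A B _ = refl

-- The last node of graft a b c is the last node of c.
graft-graftʳ : ∀ a b c d e → IsNode a → IsNode c →
               graft (graft a b c) d e ≡ graft a b (graft c d e)
graft-graftʳ (node y l (node z p q)) b c d e _ c≠leaf =
  trans (graft-right y l _ d e (graft-isNode (node z p q) b c tt))
        (cong (node y l) (graft-graftʳ (node z p q) b c d e tt c≠leaf))
graft-graftʳ (node y (node z p q) leaf) b c d e _ c≠leaf =
  trans (graft-left y _ d e (graft-isNode (node z p q) b c tt))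
        (cong (λ u → node y u leaf) (graft-graftʳ (node z p q) b c d e tt c≠leaf))
graft-graftʳ (node y leaf leaf) b c d e _ c≠leaf = graft-right y b c d e c≠leaf

-- The last node of graft b c leaf is the last node of c.
graft-graftˡ : ∀ b c d e → IsNode b → IsNode c →
               graft (graft b c leaf) d e ≡ graft b (graft c d e) leaf
graft-graftˡ (node y l (node z p q)) c d e _ c≠leaf =
  trans (graft-right y l _ d e (graft-isNode (node z p q) c leaf tt))
        (cong (node y l) (graft-graftˡ (node z p q) c d e tt c≠leaf))
graft-graftˡ (node y (node z p q) leaf) c d e _ c≠leaf =
  trans (graft-left y _ d e (graft-isNode (node z p q) c leaf tt))
        (cong (λ u → node y u leaf) (graft-graftˡ (node z p q) c d e tt c≠leaf))
graft-graftˡ (node y leaf leaf) c d e _ c≠leaf = graft-left y c d e c≠leaf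

join-assoc₁ : ∀ a b c d e → IsNode c → join (join a b c) d e ≡ join a b (join c d e)
join-assoc₁ leaf leaf c d e _ = refl
join-assoc₁ leaf (node y p q) c d e c≠leaf = begin
  join (graft b c leaf) d e   ≡⟨ join-node _ d e (graft-isNode b c leaf tt) ⟩
  graft (graft b c leaf) d e  ≡⟨ graft-graftˡ b c d e tt c≠leaf ⟩
  graft b (graft c d e) leaf  ≡⟨ cong (λ u → graft b u leaf) (join-node c d e c≠leaf) ⟨
  graft b (join c d e) leaf   ∎
  where open ≡-Reasoning; b = node y p q
join-assoc₁ (node y p q) b c d e c≠leaf = begin
  join (graft a b c) d e   ≡⟨ join-node _ d e (graft-isNode a b c tt) ⟩
  graft (graft a b c) d e  ≡⟨ graft-graftʳ a b c d e tt c≠leaf ⟩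
  graft a b (graft c d e)  ≡⟨ cong (graft a b) (join-node c d e c≠leaf) ⟨
  graft a b (join c d e)   ∎
  where open ≡-Reasoning; a = node y p q

join-assoc₂ : ∀ a b c e → IsNode c → join leaf (join a b c) e ≡ join a b (join leaf c e)
join-assoc₂ leaf leaf c e _ = refl
join-assoc₂ leaf (node y p q) c e c≠leaf = begin
  join leaf (graft b c leaf) e   ≡⟨ join-leaf _ e (graft-isNode b c leaf tt) ⟩
  graft (graft b c leaf) e leaf  ≡⟨ graft-graftˡ b c e leaf tt c≠leaf ⟩
  graft b (graft c e leaf) leaf  ≡⟨ cong (λ u → graft b u leaf) (join-leaf c e c≠leaf) ⟨
  graft b (join leaf c e) leaf   ∎
  where open ≡-Reasoning; b = node y p q
join-assoc₂ (node y p q) b c e c≠leaf = begin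
  join leaf (graft a b c) e   ≡⟨ join-leaf _ e (graft-isNode a b c tt) ⟩
  graft (graft a b c) e leaf  ≡⟨ graft-graftʳ a b c e leaf tt c≠leaf ⟩
  graft a b (graft c e leaf)  ≡⟨ cong (graft a b) (join-leaf c e c≠leaf) ⟨
  graft a b (join leaf c e)   ∎
  where open ≡-Reasoning; a = node y p q

revTree-graft : ∀ s A B → IsNode s → revTree (graft s A B) ≡ join (revTree B) (revTree A) (revTree s)
revTree-graft (node y l (node z p q)) A B _ =
  trans (cong (λ u → join u (revTree l) ⟦ y ⟧) (revTree-graft (node z p q) A B tt))
        (join-assoc₁ (revTree B) (revTree A) _ (revTree l) ⟦ y ⟧ (revTree-isNode (node z p q) tt))
revTree-graft (node y (node z p q) leaf) A B _ =
  trans (cong (λ u → join leaf u ⟦ y ⟧) (revTree-graft (node z p q) A B tt))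
        (join-assoc₂ (revTree B) (revTree A) _ ⟦ y ⟧ (revTree-isNode (node z p q) tt))
revTree-graft (node y leaf leaf) A B _ = refl

revTree-involutive : ∀ t → revTree (revTree t) ≡ t
revTree-involutive leaf = refl
revTree-involutive (node x l r@(node _ _ _)) = begin
  revTree (join (revTree r) (revTree l) ⟦ x ⟧)   ≡⟨ cong revTree (join-node (revTree r) _ _ r′≠leaf) ⟩
  revTree (graft (revTree r) (revTree l) ⟦ x ⟧)  ≡⟨ revTree-graft (revTree r) _ _ r′≠leaf ⟩
  join ⟦ x ⟧ (revTree (revTree l)) (revTree (revTree r))
    ≡⟨ cong₂ (node x) (revTree-involutive l) (revTree-involutive r) ⟩
  node x l r ∎
  where open ≡-Reasoning; r′≠leaf = revTree-isNode r tt
revTree-involutive (node x l@(node _ _ _) leaf) = begin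
  revTree (join leaf (revTree l) ⟦ x ⟧)   ≡⟨ cong revTree (join-leaf (revTree l) _ l′≠leaf) ⟩
  revTree (graft (revTree l) ⟦ x ⟧ leaf)  ≡⟨ revTree-graft (revTree l) _ _ l′≠leaf ⟩
  node x (revTree (revTree l)) leaf       ≡⟨ cong (λ u → node x u leaf) (revTree-involutive l) ⟩
  node x l leaf ∎
  where open ≡-Reasoning; l′≠leaf = revTree-isNode l tt
revTree-involutive (node x leaf leaf) = refl

preorder-graft : ∀ s A B → IsNode s → preorder (graft s A B) ≡ preorder s ++ preorder A ++ preorder B
preorder-graft (node y l (node z p q)) A B _ = cong (y ∷_) (begin
  preorder l ++ preorder (graft s A B)         ≡⟨ cong (preorder l ++_) (preorder-graft (node z p q) A B tt) ⟩
  preorder l ++ preorder s ++ preorder A ++ preorder B  ≡⟨ ++-assoc (preorder l) (preorder s) _ ⟨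
  (preorder l ++ preorder s) ++ preorder A ++ preorder B ∎)
  where open ≡-Reasoning; s = node z p q
preorder-graft (node y (node z p q) leaf) A B _ = cong (y ∷_) (begin
  preorder (graft s A B) ++ []           ≡⟨ ++-identityʳ _ ⟩
  preorder (graft s A B)                 ≡⟨ preorder-graft (node z p q) A B tt ⟩
  preorder s ++ preorder A ++ preorder B ≡⟨ cong (_++ preorder A ++ preorder B) (++-identityʳ (preorder s)) ⟨
  (preorder s ++ []) ++ preorder A ++ preorder B ∎)
  where open ≡-Reasoning; s = node z p q
preorder-graft (node y leaf leaf) A B _ = refl

preorder-join : ∀ u v w → preorder (join u v w) ≡ preorder u ++ preorder v ++ preorder w
preorder-join leaf leaf w = refl
preorder-join leaf (node y p q) w =
  trans (preorder-graft (node y p q) w leaf tt) (cong (preorder (node y p q) ++_) (++-identityʳ _))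
preorder-join (node y p q) v w = preorder-graft (node y p q) v w tt

reverse-∷-++ : ∀ (x : Label) xs ys → reverse (x ∷ xs ++ ys) ≡ reverse ys ++ reverse xs ++ [ x ]
reverse-∷-++ x xs ys = begin
  reverse (x ∷ xs ++ ys)             ≡⟨ unfold-reverse x (xs ++ ys) ⟩
  reverse (xs ++ ys) ++ [ x ]        ≡⟨ cong (_++ [ x ]) (reverse-++ xs ys) ⟩
  (reverse ys ++ reverse xs) ++ [ x ] ≡⟨ ++-assoc (reverse ys) _ _ ⟩
  reverse ys ++ reverse xs ++ [ x ]  ∎
  where open ≡-Reasoning

preorder-revTree : ∀ t → preorder (revTree t) ≡ reverse (preorder t)
preorder-revTree leaf = refl
preorder-revTree (node x l r) = begin
  preorder (join (revTree r) (revTree l) ⟦ x ⟧)          ≡⟨ preorder-join (revTree r) (revTree l) ⟦ x ⟧ ⟩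
  preorder (revTree r) ++ preorder (revTree l) ++ [ x ]
    ≡⟨ cong₂ (λ u v → u ++ v ++ [ x ]) (preorder-revTree r) (preorder-revTree l) ⟩
  reverse (preorder r) ++ reverse (preorder l) ++ [ x ]  ≡⟨ reverse-∷-++ x (preorder l) (preorder r) ⟨
  reverse (x ∷ preorder l ++ preorder r)                 ∎
  where open ≡-Reasoning

rpostorder≡reverse-preorder : ∀ t → rpostorder t ≡ reverse (preorder t)
rpostorder≡reverse-preorder leaf = refl
rpostorder≡reverse-preorder (node x l r) =
  trans (cong₂ (λ u v → u ++ v ++ [ x ]) (rpostorder≡reverse-preorder r) (rpostorder≡reverse-preorder l))
        (sym (reverse-∷-++ x (preorder l) (preorder r)))

top-revTree : ∀ t → top (revTree t) ≡ rpop t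
top-revTree t = cong initialPlus (trans (preorder-revTree t) (sym (rpostorder≡reverse-preorder t)))

rpop-revTree : ∀ t → rpop (revTree t) ≡ top t
rpop-revTree t = cong initialPlus (begin
  rpostorder (revTree t)         ≡⟨ rpostorder≡reverse-preorder (revTree t) ⟩
  reverse (preorder (revTree t)) ≡⟨ cong reverse (preorder-revTree t) ⟩
  reverse (reverse (preorder t)) ≡⟨ reverse-involutive (preorder t) ⟩
  preorder t                     ∎)
  where open ≡-Reasoning

preorder-revTree-↭ : ∀ t → preorder (revTree t) ↭ preorder t
preorder-revTree-↭ t = subst (_↭ preorder t) (sym (preorder-revTree t)) (↭-reverse (preorder t))

isMinus? : Decidable (_≡ ⊖)
isMinus? ⊕ = no λ ()
isMinus? ⊖ = yes refl

length-filter-++ : ∀ {a p} {A : Set a} {P : Pred A p} (P? : Decidable P) xs ys →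
                   length (filter P? (xs ++ ys)) ≡ length (filter P? xs) + length (filter P? ys)
length-filter-++ P? xs ys = trans (cong length (filter-++ P? xs ys)) (length-++ (filter P? xs))

omi≡count⊖-preorder : ∀ t → omi t ≡ length (filter isMinus? (preorder t))
omi≡count⊖-preorder leaf = refl
omi≡count⊖-preorder (node ⊕ l r) =
  trans (cong₂ _+_ (omi≡count⊖-preorder l) (omi≡count⊖-preorder r))
        (sym (length-filter-++ isMinus? (preorder l) (preorder r)))
omi≡count⊖-preorder (node ⊖ l r) = cong suc
  (trans (cong₂ _+_ (omi≡count⊖-preorder l) (omi≡count⊖-preorder r))
         (sym (length-filter-++ isMinus? (preorder l) (preorder r))))

size≡length-preorder : ∀ t → size t ≡ length (preorder t)
size≡length-preorder leaf = refl
size≡length-preorder (node x l r) = cong suc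
  (trans (cong₂ _+_ (size≡length-preorder l) (size≡length-preorder r)) (sym (length-++ (preorder l))))

omi-revTree : ∀ t → omi (revTree t) ≡ omi t
omi-revTree t = begin
  omi (revTree t)                                ≡⟨ omi≡count⊖-preorder (revTree t) ⟩
  length (filter isMinus? (preorder (revTree t))) ≡⟨ ↭-length (filter-↭ isMinus? (preorder-revTree-↭ t)) ⟩
  length (filter isMinus? (preorder t))           ≡⟨ omi≡count⊖-preorder t ⟨
  omi t                                          ∎
  where open ≡-Reasoning

size-revTree : ∀ t → size (revTree t) ≡ size t
size-revTree t = begin
  size (revTree t)              ≡⟨ size≡length-preorder (revTree t) ⟩
  length (preorder (revTree t)) ≡⟨ ↭-length (preorder-revTree-↭ t) ⟩
  length (preorder t)           ≡⟨ size≡length-preorder t ⟨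
  size t                        ∎
  where open ≡-Reasoning

RootDiffers : Label → Tree → Set
RootDiffers x leaf = ⊤
RootDiffers x (node y _ _) = x ≢ y

data DiSk : Tree → Set where
  leaf : DiSk leaf
  node : ∀ {x l r} → DiSk l → DiSk r → RootDiffers x r → DiSk (node x l r)

isDiSk⇒DiSk : ∀ t → T (isDiSk t) → DiSk t
isDiSk⇒DiSk leaf _ = leaf
isDiSk⇒DiSk (node x l leaf) h = node (isDiSk⇒DiSk l h) leaf tt
isDiSk⇒DiSk (node ⊕ l r@(node ⊖ _ _)) h =
  node (isDiSk⇒DiSk l (proj₁ (Equivalence.to T-∧ h))) (isDiSk⇒DiSk r (proj₂ (Equivalence.to T-∧ h))) λ ()
isDiSk⇒DiSk (node ⊖ l r@(node ⊕ _ _)) h =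
  node (isDiSk⇒DiSk l (proj₁ (Equivalence.to T-∧ h))) (isDiSk⇒DiSk r (proj₂ (Equivalence.to T-∧ h))) λ ()

DiSk⇒isDiSk : ∀ {t} → DiSk t → T (isDiSk t)
DiSk⇒isDiSk leaf = tt
DiSk⇒isDiSk {node x l leaf} (node dl _ _) = DiSk⇒isDiSk dl
DiSk⇒isDiSk {node ⊕ l (node ⊖ _ _)} (node dl dr _) = Equivalence.from T-∧ (DiSk⇒isDiSk dl , DiSk⇒isDiSk dr)
DiSk⇒isDiSk {node ⊖ l (node ⊕ _ _)} (node dl dr _) = Equivalence.from T-∧ (DiSk⇒isDiSk dl , DiSk⇒isDiSk dr)
DiSk⇒isDiSk {node ⊕ l (node ⊕ _ _)} (node _ _ ⊕≢⊕) with () ← ⊕≢⊕ refl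
DiSk⇒isDiSk {node ⊖ l (node ⊖ _ _)} (node _ _ ⊖≢⊖) with () ← ⊖≢⊖ refl

-- Label of the last node in preorder; junk on leaf.
lastLabel : Tree → Label
lastLabel leaf = ⊕
lastLabel (node y l (node z p q)) = lastLabel (node z p q)
lastLabel (node y (node z p q) leaf) = lastLabel (node z p q)
lastLabel (node y leaf leaf) = y

preorder-lastLabel : ∀ t → IsNode t → ∃ λ xs → preorder t ≡ xs ∷ʳ lastLabel t
preorder-lastLabel (node y l (node z p q)) _ with xs , eq ← preorder-lastLabel (node z p q) tt =
  y ∷ preorder l ++ xs , cong (y ∷_) (trans (cong (preorder l ++_) eq) (sym (++-assoc (preorder l) xs _)))
preorder-lastLabel (node y (node z p q) leaf) _ with xs , eq ← preorder-lastLabel (node z p q) tt =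
  y ∷ xs , cong (y ∷_) (trans (++-identityʳ _) eq)
preorder-lastLabel (node y leaf leaf) _ = [] , refl

lastLabel-revTree : ∀ x l r → lastLabel (revTree (node x l r)) ≡ x
lastLabel-revTree x l r with xs , eq ← preorder-lastLabel (revTree (node x l r)) (revTree-isNode (node x l r) tt) =
  ∷ʳ-injectiveʳ xs (reverse (preorder l ++ preorder r))
    (trans (sym eq) (trans (preorder-revTree (node x l r)) (unfold-reverse x (preorder l ++ preorder r))))

RootDiffers-graft : ∀ y t A B → IsNode t → RootDiffers y t → RootDiffers y (graft t A B)
RootDiffers-graft y (node z l (node _ _ _)) A B _ y≢z = y≢z
RootDiffers-graft y (node z (node _ _ _) leaf) A B _ y≢z = y≢z
RootDiffers-graft y (node z leaf leaf) A B _ y≢z = y≢z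

DiSk-graft : ∀ s A B → IsNode s → DiSk s → DiSk A → DiSk B → RootDiffers (lastLabel s) B → DiSk (graft s A B)
DiSk-graft (node y l (node z p q)) A B _ (node dl dr y≁r) dA dB last≁B =
  node dl (DiSk-graft (node z p q) A B tt dr dA dB last≁B) (RootDiffers-graft y (node z p q) A B tt y≁r)
DiSk-graft (node y (node z p q) leaf) A B _ (node dl _ _) dA dB last≁B =
  node (DiSk-graft (node z p q) A B tt dl dA dB last≁B) leaf tt
DiSk-graft (node y leaf leaf) A B _ _ dA dB last≁B = node dA dB last≁B

DiSk-revTree : ∀ t → DiSk t → DiSk (revTree t)
DiSk-revTree leaf leaf = leaf
DiSk-revTree (node x l r@(node z p q)) (node dl dr x≢z) =
  subst DiSk (sym (join-node (revTree r) _ _ (revTree-isNode r tt)))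
    (DiSk-graft (revTree r) (revTree l) ⟦ x ⟧ (revTree-isNode r tt) (DiSk-revTree r dr) (DiSk-revTree l dl)
      (node leaf leaf tt) (subst (_≢ x) (sym (lastLabel-revTree z p q)) (≢-sym x≢z)))
DiSk-revTree (node x l@(node _ _ _) leaf) (node dl _ _) =
  subst DiSk (sym (join-leaf (revTree l) _ (revTree-isNode l tt)))
    (DiSk-graft (revTree l) ⟦ x ⟧ leaf (revTree-isNode l tt) (DiSk-revTree l dl) (node leaf leaf tt) leaf tt)
DiSk-revTree (node x leaf leaf) _ = node leaf leaf tt

concatMap-map≡cartesianProductWith : ∀ {a b c} {A : Set a} {B : Set b} {C : Set c} (f : A → B → C) xs ys →
  concatMap (λ x → map (f x) ys) xs ≡ cartesianProductWith f xs ys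
concatMap-map≡cartesianProductWith f [] ys = refl
concatMap-map≡cartesianProductWith f (x ∷ xs) ys = cong (map (f x) ys ++_) (concatMap-map≡cartesianProductWith f xs ys)

nodesWithRoot : Label → List Tree → List Tree
nodesWithRoot x ts = cartesianProductWith (node x) ts ts

treesHeight≤-suc : ∀ d → treesHeight≤ (suc d) ≡
  leaf ∷ nodesWithRoot ⊕ (treesHeight≤ d) ++ nodesWithRoot ⊖ (treesHeight≤ d)
treesHeight≤-suc d = cong (leaf ∷_) (cong₂ _++_ (cmc ⊕) (trans (++-identityʳ _) (cmc ⊖)))
  where cmc = λ x → concatMap-map≡cartesianProductWith (node x) (treesHeight≤ d) (treesHeight≤ d)

∈-nodesWithRoot⁻ : ∀ x ts {t} → t ∈ nodesWithRoot x ts → ∃₂ λ l r → t ≡ node x l r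
∈-nodesWithRoot⁻ x ts m with l , r , _ , _ , eq ← ∈-cartesianProductWith⁻ (node x) ts ts m = l , r , eq

treesHeight≤-unique : ∀ d → Unique (treesHeight≤ d)
treesHeight≤-unique zero = [] ∷ []
treesHeight≤-unique (suc d) = subst Unique (sym (treesHeight≤-suc d))
  (All-++⁺ (All-tabulate (leaf∉ ⊕)) (All-tabulate (leaf∉ ⊖)) ∷ ++⁺ (unique ⊕) (unique ⊖) disjoint)
  where
  ts = treesHeight≤ d
  unique : ∀ x → Unique (nodesWithRoot x ts)
  unique x = cartesianProductWith⁺ (node x) (λ { refl → refl , refl }) (treesHeight≤-unique d) (treesHeight≤-unique d)
  leaf∉ : ∀ x {t} → t ∈ nodesWithRoot x ts → leaf ≢ t
  leaf∉ x m with _ , _ , refl ← ∈-nodesWithRoot⁻ x ts m = λ ()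
  disjoint : ∀ {t} → ¬ (t ∈ nodesWithRoot ⊕ ts × t ∈ nodesWithRoot ⊖ ts)
  disjoint (m⊕ , m⊖) with _ , _ , refl ← ∈-nodesWithRoot⁻ ⊕ ts m⊕ | _ , _ , () ← ∈-nodesWithRoot⁻ ⊖ ts m⊖

treesHeight≤-complete : ∀ d t → size t ≤ d → t ∈ treesHeight≤ d
treesHeight≤-complete zero leaf _ = here refl
treesHeight≤-complete (suc d) leaf _ = here refl
treesHeight≤-complete (suc d) (node x l r) (s≤s h) =
  subst (node x l r ∈_) (sym (treesHeight≤-suc d)) (there (∈-byRoot x))
  where
  ts = treesHeight≤ d
  ∈-nodes : ∀ x → node x l r ∈ nodesWithRoot x ts
  ∈-nodes x = ∈-cartesianProductWith⁺ (node x)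
    (treesHeight≤-complete d l (m+n≤o⇒m≤o (size l) h)) (treesHeight≤-complete d r (m+n≤o⇒n≤o (size l) h))
  ∈-byRoot : ∀ x → node x l r ∈ nodesWithRoot ⊕ ts ++ nodesWithRoot ⊖ ts
  ∈-byRoot ⊕ = ∈-++⁺ˡ (∈-nodes ⊕)
  ∈-byRoot ⊖ = ∈-++⁺ʳ _ (∈-nodes ⊖)

∈-DT⁻ : ∀ n {t} → t ∈ DT n → size t ≡ n ∸ 1 × DiSk t
∈-DT⁻ n {t} t∈ with size≡ , dt ← Equivalence.to T-∧ (proj₂ (∈-filter⁻ _ {xs = treesHeight≤ (n ∸ 1)} t∈)) =
  ≡ᵇ⇒≡ (size t) (n ∸ 1) size≡ , isDiSk⇒DiSk t dt

∈-DT⁺ : ∀ n {t} → size t ≡ n ∸ 1 → DiSk t → t ∈ DT n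
∈-DT⁺ n {t} size≡ dt = ∈-filter⁺ _ (treesHeight≤-complete (n ∸ 1) t (≤-reflexive size≡))
  (Equivalence.from T-∧ (≡⇒≡ᵇ (size t) (n ∸ 1) size≡ , DiSk⇒isDiSk dt))

revTree-∈-DT : ∀ n {t} → t ∈ DT n → revTree t ∈ DT n
revTree-∈-DT n {t} t∈ with size≡ , dt ← ∈-DT⁻ n t∈ = ∈-DT⁺ n (trans (size-revTree t) size≡) (DiSk-revTree t dt)

involution-↭ : ∀ {a} {A : Set a} (f : A → A) {xs} → (∀ x → f (f x) ≡ x) → Unique xs →
               (∀ {x} → x ∈ xs → f x ∈ xs) → map f xs ↭ xs
involution-↭ f {xs} f∘f≗id uxs f∈ = ∼bag⇒↭ (unique∧set⇒bag (map⁺ f-injective uxs) uxs (mk⇔ to from))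
  where
  f-injective : ∀ {x y} → f x ≡ f y → x ≡ y
  f-injective {x} {y} fx≡fy = trans (sym (f∘f≗id x)) (trans (cong f fx≡fy) (f∘f≗id y))
  to : ∀ {x} → x ∈ map f xs → x ∈ xs
  to x∈ with _ , y∈ , refl ← ∈-map⁻ f x∈ = f∈ y∈
  from : ∀ {x} → x ∈ xs → x ∈ map f xs
  from {x} x∈ = subst (_∈ map f xs) (f∘f≗id x) (∈-map⁺ f (f∈ x∈))

revTree-↭-DT : ∀ n → map revTree (DT n) ↭ DT n
revTree-↭-DT n = involution-↭ revTree revTree-involutive
  (filter⁺ _ {xs = treesHeight≤ (n ∸ 1)} (treesHeight≤-unique (n ∸ 1))) (revTree-∈-DT n)

length-filter-map : ∀ {a b p} {A : Set a} {B : Set b} {P : Pred B p} (P? : Decidable P) (f : A → B) xs →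
                    length (filter P? (map f xs)) ≡ length (filter (P? ∘ f) xs)
length-filter-map P? f [] = refl
length-filter-map P? f (x ∷ xs) with does (P? (f x))
... | true = cong suc (length-filter-map P? f xs)
... | false = length-filter-map P? f xs

theorem4p2 : (n : ℕ) → n ≥ 1 → (a b c : ℕ) →
    count3 omi rpop top (DT n) a b c ≡ count3 omi top rpop (DT n) a b c
theorem4p2 n _ a b c = begin
  length (filter (T? ∘ P) (DT n))                ≡⟨ cong length (filter-≐ (T? ∘ P) (T? ∘ Q ∘ revTree) P≐Q∘revTree (DT n)) ⟩
  length (filter (T? ∘ Q ∘ revTree) (DT n))      ≡⟨ length-filter-map (T? ∘ Q) revTree (DT n) ⟨
  length (filter (T? ∘ Q) (map revTree (DT n)))  ≡⟨ ↭-length (filter-↭ (T? ∘ Q) (revTree-↭-DT n)) ⟩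
  length (filter (T? ∘ Q) (DT n))                ∎
  where
  open ≡-Reasoning
  P Q : Tree → Bool
  P t = (omi t ≡ᵇ a) ∧ (rpop t ≡ᵇ b) ∧ (top t ≡ᵇ c)
  Q t = (omi t ≡ᵇ a) ∧ (top t ≡ᵇ b) ∧ (rpop t ≡ᵇ c)
  P≗Q∘revTree : ∀ t → P t ≡ Q (revTree t)
  P≗Q∘revTree t rewrite omi-revTree t | top-revTree t | rpop-revTree t = refl
  P≐Q∘revTree : (T ∘ P) ≐ (T ∘ Q ∘ revTree)
  P≐Q∘revTree = (λ {t} → subst T (P≗Q∘revTree t)) , (λ {t} → subst T (sym (P≗Q∘revTree t)))
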